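{- Let $D$ be a northwest diagram whose first column is exactly $C_k$. Then $D-C_k$ is also northwest, and $\mathfrak{K}_D=x_1x_2\cdots x_k\,\mathfrak{K}_{D-C_k}$.
   Context: A diagram is a finite set of cells $(i,j)\in\mathbb{Z}_{>0}^2$ ($i$ row, $j$ column), rows numbered top to bottom. $D$ is northwest if whenever $(j,k),(i,l)\in D$ with $i<j$, $k<l$, then $(i,k)\in D$. $C_k$ is the set of cells in rows $1,\dots,k$ of column $1$, and $D-C_k$ is $D$ with these cells removed. A Kohnert move selects the rightmost cell of a row and moves it up (toward row 1) within its column to the first empty position above it, jumping over cells, if one exists; $\mathrm{KD}(D)$ is the set of diagrams reachable from $D$ by Kohnert moves (including $D$). $\mathbf{wt}(T)$ is the vector of row counts of $T$ and $\mathfrak{K}_D=\sum_{T\in\mathrm{KD}(D)}x^{\mathbf{wt}(T)}$, with $\mathfrak{K}_\varnothing=1$. -}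

module Defs where

open import Data.Nat using (ℕ; zero; suc; _<_)
open import Data.Bool using (Bool; true; false)
open import Data.Fin using (Fin; toℕ)
open import Data.Vec using (Vec; []; _∷_; _[_]≔_; _[_]%=_)
open import Data.Product using (Σ; _×_)
open import Relation.Binary.PropositionalEquality using (_≡_)
open import Relation.Binary.Construct.Closure.ReflexiveTransitive using (Star)

-- Conventions: rows and columns are 0-indexed internally; internal row i,
-- column j is the paper's cell (i+1, j+1).  A diagram contained in rows
-- 1..n and columns 1..m is a Boolean grid (Vec of n rows of m Booleans);
-- every finite diagram fits in some such grid, and Kohnert moves (which
-- only move cells up within their column) never leave it.
Grid : ℕ → ℕ → Set
Grid n m = Vec (Vec Bool m) n

cellRow : ∀ {m} → Vec Bool m → ℕ → Bool
cellRow []       _       = false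
cellRow (b ∷ _)  zero    = b
cellRow (_ ∷ bs) (suc j) = cellRow bs j

-- membership of cell (row i, column j); false outside the grid
cell : ∀ {n m} → Grid n m → ℕ → ℕ → Bool
cell []       _       _ = false
cell (r ∷ _)  zero    j = cellRow r j
cell (_ ∷ rs) (suc i) j = cell rs i j

setCell : ∀ {n m} → Grid n m → Fin n → Fin m → Bool → Grid n m
setCell D r c b = D [ r ]%= (λ row → row [ c ]≔ b)

Northwest : ∀ {n m} → Grid n m → Set
Northwest D = ∀ i j k l → i < j → k < l →
  cell D j k ≡ true → cell D i l ≡ true → cell D i k ≡ true

clear0 : ∀ {m} → Vec Bool m → Vec Bool m
clear0 []       = []
clear0 (_ ∷ bs) = false ∷ bs

removeC : ∀ {n m} → ℕ → Grid n m → Grid n m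
removeC zero    D         = D
removeC (suc k) []        = []
removeC (suc k) (r ∷ rs)  = clear0 r ∷ removeC k rs

KohnertMove : ∀ {n m} → Grid n m → Grid n m → Set
KohnertMove {n} {m} D T =
  Σ (Fin n) λ r → Σ (Fin m) λ c → Σ (Fin n) λ r' →
    cell D (toℕ r) (toℕ c) ≡ true ×
    (∀ c' → toℕ c < c' → cell D (toℕ r) c' ≡ false) ×
    toℕ r' < toℕ r ×
    cell D (toℕ r') (toℕ c) ≡ false ×
    (∀ r'' → toℕ r' < r'' → r'' < toℕ r → cell D r'' (toℕ c) ≡ true) ×
    T ≡ setCell (setCell D r c false) r' c true

Reach : ∀ {n m} → Grid n m → Grid n m → Set
Reach = Star KohnertMove

countTrue : ∀ {m} → Vec Bool m → ℕ
countTrue []           = zero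
countTrue (true ∷ bs)  = suc (countTrue bs)
countTrue (false ∷ bs) = countTrue bs

-- wt(T): row counts (rows beyond n are empty, so length n suffices)
wt : ∀ {n m} → Grid n m → Vec ℕ n
wt []       = []
wt (r ∷ rs) = countTrue r ∷ wt rs

addOnes : ∀ {n} → ℕ → Vec ℕ n → Vec ℕ n
addOnes zero    v        = v
addOnes (suc k) []       = []
addOnes (suc k) (x ∷ v)  = suc x ∷ addOnes k v

{-# OPTIONS --safe #-}
-- Column 1 of D is C_k, which is top-justified: an occupied cell of it has no
-- empty cell above, so no Kohnert move ever acts in column 1, and every T in
-- KD(D) still has column 1 equal to C_k.  Moves in the other columns do not
-- look at column 1, so overwriting column 1 commutes with Kohnert moves.  The
-- empty column of D - C_k is top-justified as well; hence erasing column 1 and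
-- re-inserting C_k are mutually inverse bijections between KD(D) and
-- KD(D - C_k), and erasing lowers each of the first k row counts by one.
module Submission where

open import Defs
open import Data.Nat using (ℕ; zero; suc; _<_; _≤_; z≤n; s≤s)
open import Data.Nat.Properties using (<-trans; <⇒≱; m<n⇒n≢0)
open import Data.Bool using (Bool; true; false)
open import Data.Bool.Properties using (¬-not)
open import Data.Fin as Fin using (Fin; toℕ)
open import Data.Vec as Vec using (Vec; []; _∷_; _[_]≔_; replicate; zipWith)
open import Data.Product using (_×_; _,_)
open import Data.List using (List; map)
open import Data.List.Properties using (map-∘; map-id-local; map-cong-local)
open import Data.List.Membership.Propositional using (_∈_)
open import Data.List.Membership.Propositional.Properties using (∈-map⁺; ∈-map⁻)
open import Data.List.Membership.Propositional.Properties.WithK using (unique∧set⇒bag)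
import Data.List.Relation.Unary.All as All
open import Data.List.Relation.Unary.Unique.Propositional using (Unique)
import Data.List.Relation.Unary.Unique.Propositional.Properties as Unique
open import Data.List.Relation.Binary.Permutation.Propositional
  using (_↭_; module PermutationReasoning)
import Data.List.Relation.Binary.Permutation.Propositional.Properties as ↭
open import Data.List.Relation.Binary.BagAndSetEquality using (∼bag⇒↭)
open import Function using (_∘_; _⇔_; mk⇔; Equivalence)
open import Relation.Binary.PropositionalEquality
  using (_≡_; _≢_; refl; sym; trans; cong; cong₂; subst)
open import Relation.Binary.Construct.Closure.ReflexiveTransitive using (ε; _◅_)
open import Relation.Nullary using (contradiction)

open Equivalence using (to; from)

private
  variable
    n m : ℕ

map-↭-bijectionOn : ∀ {A B : Set} {P : A → Set} {Q : B → Set} {xs : List A} {ys : List B}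
  (f : A → B) (g : B → A) →
  (∀ {x} → P x → Q (f x)) → (∀ {y} → Q y → P (g y)) →
  (∀ {x} → P x → g (f x) ≡ x) → (∀ {y} → Q y → f (g y) ≡ y) →
  Unique xs → (∀ x → (x ∈ xs) ⇔ P x) → Unique ys → (∀ y → (y ∈ ys) ⇔ Q y) →
  map f xs ↭ ys
map-↭-bijectionOn {Q = Q} {xs} {ys} f g f-maps g-maps g∘f f∘g xs! xs≡P ys! ys≡Q =
  ∼bag⇒↭ (unique∧set⇒bag fxs! ys! (mk⇔ image⊆ys ys⊆image))
  where
  g∘f-on-xs : map g (map f xs) ≡ xs
  g∘f-on-xs = trans (sym (map-∘ xs)) (map-id-local (All.tabulate (g∘f ∘ to (xs≡P _))))

  fxs! : Unique (map f xs)
  fxs! = Unique.map⁻ (subst Unique (sym g∘f-on-xs) xs!)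

  image⊆ys : ∀ {y} → y ∈ map f xs → y ∈ ys
  image⊆ys y∈fxs with ∈-map⁻ f y∈fxs
  ... | x , x∈xs , refl = from (ys≡Q _) (f-maps (to (xs≡P x) x∈xs))

  ys⊆image : ∀ {y} → y ∈ ys → y ∈ map f xs
  ys⊆image {y} y∈ys = subst (_∈ map f xs) (f∘g Qy) (∈-map⁺ f (from (xs≡P _) (g-maps Qy)))
    where
    Qy : Q y
    Qy = to (ys≡Q y) y∈ys

-- For m = 0 there is no column 0: column₀ reads false and setColumn₀ does nothing.
column₀ : Grid n m → Vec Bool n
column₀ = Vec.map (λ row → cellRow row 0)

setHead : Bool → Vec Bool m → Vec Bool m
setHead b []       = []
setHead b (_ ∷ xs) = b ∷ xs

setColumn₀ : Vec Bool n → Grid n m → Grid n m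
setColumn₀ = zipWith setHead

clearColumn₀ : Grid n m → Grid n m
clearColumn₀ = setColumn₀ (replicate _ false)

cell-column₀ : ∀ (A : Grid n m) i → cellRow (column₀ A) i ≡ cell A i 0
cell-column₀ []      i       = refl
cell-column₀ (_ ∷ A) zero    = refl
cell-column₀ (_ ∷ A) (suc i) = cell-column₀ A i

cell-column₀-cong : ∀ (A B : Grid n m) → column₀ A ≡ column₀ B → ∀ i → cell A i 0 ≡ cell B i 0
cell-column₀-cong A B eq i =
  trans (sym (cell-column₀ A i)) (trans (cong (λ v → cellRow v i) eq) (cell-column₀ B i))

cell-setColumn₀ : ∀ (v : Vec Bool n) (A : Grid n m) i {j} → j ≢ 0 →
  cell (setColumn₀ v A) i j ≡ cell A i j
cell-setColumn₀ v       A               i       {zero}  j≢0 = contradiction refl j≢0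
cell-setColumn₀ []      []              i       {suc j} _   = refl
cell-setColumn₀ (_ ∷ v) ([] ∷ A)        zero    {suc j} _   = refl
cell-setColumn₀ (_ ∷ v) ((_ ∷ _) ∷ A)   zero    {suc j} _   = refl
cell-setColumn₀ (_ ∷ v) (_ ∷ A)         (suc i) {suc j} j≢0 = cell-setColumn₀ v A i j≢0

cell-clearColumn₀ : ∀ (A : Grid n m) i → cell (clearColumn₀ A) i 0 ≡ false
cell-clearColumn₀ []              i       = refl
cell-clearColumn₀ ([] ∷ A)        zero    = refl
cell-clearColumn₀ ((_ ∷ _) ∷ A)   zero    = refl
cell-clearColumn₀ (_ ∷ A)         (suc i) = cell-clearColumn₀ A i

column₀-clearColumn₀ : ∀ (A : Grid n m) → column₀ (clearColumn₀ A) ≡ replicate n false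
column₀-clearColumn₀ []        = refl
column₀-clearColumn₀ (row ∷ A) = cong₂ _∷_ (cell-clearColumn₀ (row ∷ A) 0) (column₀-clearColumn₀ A)

setHead-cellRow : ∀ (row : Vec Bool m) → setHead (cellRow row 0) row ≡ row
setHead-cellRow []      = refl
setHead-cellRow (_ ∷ _) = refl

setHead-setHead : ∀ x y (row : Vec Bool m) → setHead x (setHead y row) ≡ setHead x row
setHead-setHead x y []      = refl
setHead-setHead x y (_ ∷ _) = refl

setColumn₀-column₀ : ∀ (A : Grid n m) → setColumn₀ (column₀ A) A ≡ A
setColumn₀-column₀ []        = refl
setColumn₀-column₀ (row ∷ A) = cong₂ _∷_ (setHead-cellRow row) (setColumn₀-column₀ A)

setColumn₀-setColumn₀ : ∀ (v w : Vec Bool n) (A : Grid n m) →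
  setColumn₀ v (setColumn₀ w A) ≡ setColumn₀ v A
setColumn₀-setColumn₀ []      []      []        = refl
setColumn₀-setColumn₀ (x ∷ v) (y ∷ w) (row ∷ A) =
  cong₂ _∷_ (setHead-setHead x y row) (setColumn₀-setColumn₀ v w A)

setColumn₀-inverse : ∀ {v} (w : Vec Bool n) {A : Grid n m} → column₀ A ≡ v →
  setColumn₀ v (setColumn₀ w A) ≡ A
setColumn₀-inverse w {A} refl = trans (setColumn₀-setColumn₀ (column₀ A) w A) (setColumn₀-column₀ A)

setHead-[]≔ : ∀ x (row : Vec Bool m) (c : Fin m) b → toℕ c ≢ 0 →
  setHead x (row [ c ]≔ b) ≡ setHead x row [ c ]≔ b
setHead-[]≔ x (_ ∷ _) Fin.zero    b c≢0 = contradiction refl c≢0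
setHead-[]≔ x (_ ∷ _) (Fin.suc c) b _   = refl

cellRow₀-[]≔ : ∀ (row : Vec Bool m) (c : Fin m) b → toℕ c ≢ 0 →
  cellRow (row [ c ]≔ b) 0 ≡ cellRow row 0
cellRow₀-[]≔ (_ ∷ _) Fin.zero    b c≢0 = contradiction refl c≢0
cellRow₀-[]≔ (_ ∷ _) (Fin.suc c) b _   = refl

setColumn₀-setCell : ∀ (v : Vec Bool n) (A : Grid n m) r c b → toℕ c ≢ 0 →
  setColumn₀ v (setCell A r c b) ≡ setCell (setColumn₀ v A) r c b
setColumn₀-setCell (x ∷ v) (row ∷ A) Fin.zero    c b c≢0 =
  cong (_∷ setColumn₀ v A) (setHead-[]≔ x row c b c≢0)
setColumn₀-setCell (x ∷ v) (row ∷ A) (Fin.suc r) c b c≢0 =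
  cong (setHead x row ∷_) (setColumn₀-setCell v A r c b c≢0)

column₀-setCell : ∀ (A : Grid n m) r c b → toℕ c ≢ 0 → column₀ (setCell A r c b) ≡ column₀ A
column₀-setCell (row ∷ A) Fin.zero    c b c≢0 = cong (_∷ column₀ A) (cellRow₀-[]≔ row c b c≢0)
column₀-setCell (row ∷ A) (Fin.suc r) c b c≢0 = cong (cellRow row 0 ∷_) (column₀-setCell A r c b c≢0)

TopJustified : Vec Bool n → Set
TopJustified v = ∀ {i i'} → i' < i → cellRow v i ≡ true → cellRow v i' ≡ true

topJustified-clearColumn₀ : ∀ (A : Grid n m) → TopJustified (column₀ (clearColumn₀ A))
topJustified-clearColumn₀ A {i} _ occupied =
  contradiction (trans (sym (cell-clearColumn₀ A i)) (trans (sym (cell-column₀ (clearColumn₀ A) i)) occupied)) λ ()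

kohnert-column≢0 : ∀ (A : Grid n m) {r r' c} → TopJustified (column₀ A) →
  cell A r c ≡ true → r' < r → cell A r' c ≡ false → c ≢ 0
kohnert-column≢0 A {r} {r'} top occupied r'<r vacant refl =
  contradiction (trans (sym vacant) (trans (sym (cell-column₀ A r')) (top r'<r (trans (cell-column₀ A r) occupied))))
                λ ()

kohnertMove-column₀ : ∀ {A B : Grid n m} → TopJustified (column₀ A) → KohnertMove A B →
  column₀ B ≡ column₀ A
kohnertMove-column₀ {A = A} top (r , c , r' , occupied , _ , r'<r , vacant , _ , refl) =
  trans (column₀-setCell _ r' c true c≢0) (column₀-setCell A r c false c≢0)
  where
  c≢0 : toℕ c ≢ 0
  c≢0 = kohnert-column≢0 A top occupied r'<r vacant

kohnertMove-setColumn₀ : ∀ {A B : Grid n m} (v : Vec Bool n) → TopJustified (column₀ A) →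
  KohnertMove A B → KohnertMove (setColumn₀ v A) (setColumn₀ v B)
kohnertMove-setColumn₀ {A = A} v top (r , c , r' , occupied , rightmost , r'<r , vacant , filled , refl) =
  r , c , r' , unchanged occupied ,
  (λ c' c<c' → trans (cell-setColumn₀ v A _ (m<n⇒n≢0 c<c')) (rightmost c' c<c')) ,
  r'<r , unchanged vacant , (λ r'' r'<r'' r''<r → unchanged (filled r'' r'<r'' r''<r)) ,
  trans (setColumn₀-setCell v _ r' c true c≢0)
        (cong (λ X → setCell X r' c true) (setColumn₀-setCell v A r c false c≢0))
  where
  c≢0 : toℕ c ≢ 0
  c≢0 = kohnert-column≢0 A top occupied r'<r vacant

  unchanged : ∀ {i b} → cell A i (toℕ c) ≡ b → cell (setColumn₀ v A) i (toℕ c) ≡ b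
  unchanged = trans (cell-setColumn₀ v A _ c≢0)

reach-column₀ : ∀ {A B : Grid n m} → TopJustified (column₀ A) → Reach A B → column₀ B ≡ column₀ A
reach-column₀ top ε = refl
reach-column₀ {A = A} top (_◅_ {j = A'} move moves) =
  trans (reach-column₀ (subst TopJustified (sym step) top) moves) step
  where
  step : column₀ A' ≡ column₀ A
  step = kohnertMove-column₀ top move

reach-setColumn₀ : ∀ {A B : Grid n m} (v : Vec Bool n) → TopJustified (column₀ A) →
  Reach A B → Reach (setColumn₀ v A) (setColumn₀ v B)
reach-setColumn₀ v top ε              = ε
reach-setColumn₀ v top (move ◅ moves) =
  kohnertMove-setColumn₀ v top move ◅
  reach-setColumn₀ v (subst TopJustified (sym (kohnertMove-column₀ top move)) top) moves

kohnertDiagrams-clearColumn₀ : ∀ {D : Grid n m} {L L' : List (Grid n m)} → TopJustified (column₀ D) →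
  Unique L → (∀ T → (T ∈ L) ⇔ Reach D T) →
  Unique L' → (∀ S → (S ∈ L') ⇔ Reach (clearColumn₀ D) S) →
  map clearColumn₀ L ↭ L'
kohnertDiagrams-clearColumn₀ {n = n} {m} {D} top =
  map-↭-bijectionOn clearColumn₀ restore (reach-setColumn₀ _ top) restore-reach
    (λ reach → setColumn₀-inverse _ (reach-column₀ top reach))
    (λ reach → setColumn₀-inverse _ (trans (reach-column₀ top′ reach) (column₀-clearColumn₀ D)))
  where
  restore : Grid n m → Grid n m
  restore = setColumn₀ (column₀ D)

  top′ : TopJustified (column₀ (clearColumn₀ D))
  top′ = topJustified-clearColumn₀ D

  restore-reach : ∀ {S} → Reach (clearColumn₀ D) S → Reach D (restore S)
  restore-reach {S} reach =
    subst (λ X → Reach X (restore S)) (setColumn₀-inverse _ refl) (reach-setColumn₀ _ top′ reach)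

northwest-clearColumn₀ : ∀ (D : Grid n m) → Northwest D → Northwest (clearColumn₀ D)
northwest-clearColumn₀ D nw i j zero l _ _ below _ =
  contradiction (trans (sym (cell-clearColumn₀ D j)) below) λ ()
northwest-clearColumn₀ D nw i j (suc c) l i<j c<l below right =
  trans kept (nw i j (suc c) l i<j c<l (trans (sym kept) below)
                 (trans (sym (cell-setColumn₀ (replicate _ false) D i (m<n⇒n≢0 c<l))) right))
  where
  kept : ∀ {r} → cell (clearColumn₀ D) r (suc c) ≡ cell D r (suc c)
  kept = cell-setColumn₀ (replicate _ false) D _ λ ()

Column₀≡C : ℕ → Grid n m → Set
Column₀≡C k A = ∀ i → (cell A i 0 ≡ true) ⇔ (i < k)

Column₀≡C-cong : ∀ {k} (A B : Grid n m) → column₀ A ≡ column₀ B → Column₀≡C k A → Column₀≡C k B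
Column₀≡C-cong {k = k} A B eq isC i = subst (λ b → (b ≡ true) ⇔ (i < k)) (cell-column₀-cong A B eq i) (isC i)

Column₀≡C⇒topJustified : ∀ {k} (A : Grid n m) → Column₀≡C k A → TopJustified (column₀ A)
Column₀≡C⇒topJustified A isC {i} {i'} i'<i occupied =
  trans (cell-column₀ A i') (from (isC i') (<-trans i'<i (to (isC i) (trans (sym (cell-column₀ A i)) occupied))))

Column₀≡C⇒vacant : ∀ {k} (A : Grid n m) → Column₀≡C k A → ∀ i → k ≤ i → cell A i 0 ≡ false
Column₀≡C⇒vacant A isC i k≤i = ¬-not (λ occupied → <⇒≱ (to (isC i) occupied) k≤i)

removeC-clearColumn₀ : ∀ k (A : Grid n m) → (∀ i → k ≤ i → cell A i 0 ≡ false) →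
  removeC k A ≡ clearColumn₀ A
removeC-clearColumn₀ zero    []        _      = refl
removeC-clearColumn₀ (suc k) []        _      = refl
removeC-clearColumn₀ zero    (row ∷ A) vacant =
  cong₂ _∷_ (sym (setHead-vacant row (vacant 0 z≤n))) (removeC-clearColumn₀ zero A (λ i _ → vacant (suc i) z≤n))
  where
  setHead-vacant : ∀ {m} (row : Vec Bool m) → cellRow row 0 ≡ false → setHead false row ≡ row
  setHead-vacant []          _ = refl
  setHead-vacant (false ∷ _) _ = refl
removeC-clearColumn₀ (suc k) (row ∷ A) vacant =
  cong₂ _∷_ (clear0≡setHead row) (removeC-clearColumn₀ k A (λ i k≤i → vacant (suc i) (s≤s k≤i)))
  where
  clear0≡setHead : ∀ {m} (row : Vec Bool m) → clear0 row ≡ setHead false row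
  clear0≡setHead []      = refl
  clear0≡setHead (_ ∷ _) = refl

wt-removeC : ∀ k (A : Grid n m) → (∀ i → i < k → cell A i 0 ≡ true) → wt A ≡ addOnes k (wt (removeC k A))
wt-removeC zero    A                   _        = refl
wt-removeC (suc k) []                  _        = refl
wt-removeC (suc k) ([] ∷ _)            occupied = contradiction (occupied 0 (s≤s z≤n)) λ ()
wt-removeC (suc k) ((false ∷ _) ∷ _)   occupied = contradiction (occupied 0 (s≤s z≤n)) λ ()
wt-removeC (suc k) ((true ∷ row) ∷ A)  occupied =
  cong (suc (countTrue row) ∷_) (wt-removeC k A (λ i i<k → occupied (suc i) (s≤s i<k)))

wt-clearColumn₀ : ∀ k (A : Grid n m) → Column₀≡C k A → wt A ≡ addOnes k (wt (clearColumn₀ A))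
wt-clearColumn₀ k A isC =
  trans (wt-removeC k A (λ i → from (isC i)))
        (cong (addOnes k ∘ wt) (removeC-clearColumn₀ k A (Column₀≡C⇒vacant A isC)))

lemma2p16 : ∀ {n m} (k : ℕ) (D : Grid n m) →
    Northwest D →
    (∀ i → (cell D i 0 ≡ true) ⇔ (i < k)) →
    Northwest (removeC k D) ×
    ((L L' : List (Grid n m)) →
      Unique L → (∀ T → (T ∈ L) ⇔ Reach D T) →
      Unique L' → (∀ T → (T ∈ L') ⇔ Reach (removeC k D) T) →
      map wt L ↭ map (addOnes k ∘ wt) L')
lemma2p16 k D northwest isC = subst Northwest (sym D-Cₖ≡) (northwest-clearColumn₀ D northwest) , weights
  where
  D-Cₖ≡ : removeC k D ≡ clearColumn₀ D
  D-Cₖ≡ = removeC-clearColumn₀ k D (Column₀≡C⇒vacant D isC)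

  top : TopJustified (column₀ D)
  top = Column₀≡C⇒topJustified D isC

  weights : ∀ L L' → Unique L → (∀ T → (T ∈ L) ⇔ Reach D T) →
    Unique L' → (∀ T → (T ∈ L') ⇔ Reach (removeC k D) T) → map wt L ↭ map (addOnes k ∘ wt) L'
  weights L L' L! L≡KD L'! L'≡KD = begin
    map wt L                                  ≡⟨ map-cong-local (All.tabulate wt-KD) ⟩
    map (addOnes k ∘ wt ∘ clearColumn₀) L     ≡⟨ map-∘ L ⟩
    map (addOnes k ∘ wt) (map clearColumn₀ L) ↭⟨ ↭.map⁺ (addOnes k ∘ wt) clearing-is-bijective ⟩
    map (addOnes k ∘ wt) L'                   ∎
    where
    open PermutationReasoning

    wt-KD : ∀ {T} → T ∈ L → wt T ≡ addOnes k (wt (clearColumn₀ T))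
    wt-KD T∈L = wt-clearColumn₀ k _ (Column₀≡C-cong D _ (sym (reach-column₀ top (to (L≡KD _) T∈L))) isC)

    clearing-is-bijective : map clearColumn₀ L ↭ L'
    clearing-is-bijective = kohnertDiagrams-clearColumn₀ top L! L≡KD L'!
      (subst (λ X → ∀ S → (S ∈ L') ⇔ Reach X S) D-Cₖ≡ L'≡KD)
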